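{- For any permutation $\pi$ on $[n]$, $$\sum_{t=1}^n\big(v_\pi^{\leftarrow}[t]+v_\pi^{\rightarrow}[t]\big)^2\le4\|v_{\mathrm{id}}-v_\pi\|^2.$$
   Context: $\mathrm{id}$ is the identity permutation on $[n]$. For a permutation $\pi$, $\pi^{ -1}(i)$ is the position of element $i$, $v_\pi=(\pi^{ -1}(1),\dots,\pi^{ -1}(n))$, and $\|\cdot\|$ is the Euclidean norm. $v_\pi^{\leftarrow}[t]$ is the number of elements $j<t$ with $\pi^{ -1}(j)>\pi^{ -1}(t)$, and $v_\pi^{\rightarrow}[t]$ is the number of elements $j>t$ with $\pi^{ -1}(j)<\pi^{ -1}(t)$. -}

module Defs where

open import Data.Nat using (ℕ; _+_; _*_; ∣_-_∣)
open import Data.Fin using (Fin; toℕ; _<?_; _<_)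
open import Data.Fin.Permutation using (Permutation′; _⟨$⟩ʳ_; _⟨$⟩ˡ_)
open import Data.Nat.ListAction using (sum)
open import Data.List using (List; map; allFin; filter; length)
open import Data.Product using (_×_)
open import Relation.Nullary.Decidable using (_×-dec_)

Σ[_]_ : (n : ℕ) → (Fin n → ℕ) → ℕ
Σ[ n ] f = sum (map f (allFin n))

-- A permutation π on [n] (0-indexed as Fin n): π ⟨$⟩ʳ p is the element at position p,
-- so π⁻¹(i) = π ⟨$⟩ˡ i is the position of element i.
pos : {n : ℕ} → Permutation′ n → Fin n → Fin n
pos π i = π ⟨$⟩ˡ i

vLeft : {n : ℕ} → Permutation′ n → Fin n → ℕ
vLeft {n} π t = length (filter (λ j → (j <? t) ×-dec (pos π t <? pos π j)) (allFin n))

vRight : {n : ℕ} → Permutation′ n → Fin n → ℕ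
vRight {n} π t = length (filter (λ j → (t <? j) ×-dec (pos π j <? pos π t)) (allFin n))

-- ‖v_id − v_π‖² = Σ_i (i − π⁻¹(i))²
normSqDiffId : {n : ℕ} → Permutation′ n → ℕ
normSqDiffId {n} π = Σ[ n ] (λ i → ∣ toℕ i - toℕ (pos π i) ∣ * ∣ toℕ i - toℕ (pos π i) ∣)

{-# OPTIONS --safe #-}
-- Write ρ t for the position π⁻¹(t), and L t, R t for v^←[t], v^→[t]. The L t elements j < t
-- placed after t have distinct values, so their gaps t − j add up to at least L t (L t + 1) / 2;
-- symmetrically, the R t elements placed before t have position gaps ρ t − ρ j adding up to at
-- least R t (R t + 1) / 2. Hence (L t + R t)² ≤ 2 (L t² + R t²) is at most 4 times the total gap
-- at t. Weighting the identity t + R t = ρ t + L t by t and by ρ t shows that the two gap totals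
-- are Σ t² − Σ t ρ t and Σ ρ t² − Σ t ρ t, which add up to Σ (t − ρ t)².
module Submission where

open import Defs
open import Data.Nat using (ℕ; _≤_; _+_; _*_)
open import Data.Fin.Permutation using (Permutation′)

open import Data.Bool.Base using (true; false; if_then_else_)
open import Data.Fin.Base using (Fin; zero; suc; toℕ)
import Data.Fin.Properties as Fin
open import Data.Fin.Permutation using (_⟨$⟩ʳ_; flip; inverseʳ)
open import Data.List.Base using (tabulate; map; filter; length)
import Data.Nat.ListAction as List
open import Data.Nat.Base using (zero; suc; _∸_; _<_; ∣_-_∣; z≤n; s≤s; s≤s⁻¹)
open import Data.Nat.Properties
open import Data.Nat.Tactic.RingSolver using (solve-∀)
open import Data.Product using (_,_)
open import Data.Sum using (inj₁; inj₂)
open import Function.Base using (id; _∘′_)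
open import Function.Definitions using (Injective)
open import Relation.Binary.Definitions using (tri<; tri≈; tri>)
open import Relation.Binary.PropositionalEquality
open import Relation.Nullary using (Dec; does; yes; no; ¬_; contradiction)
open import Relation.Nullary.Decidable using (_×-dec_)
open import Relation.Unary using (Pred; Decidable)
open import Algebra.Properties.Semiring.Sum +-*-semiring
  using (sum-syntax; sum-cong-≗; sum-replicate-zero; ∑-distrib-+; ∑-comm; ∑-permute; *-distribˡ-sum; *-distribʳ-sum)

𝟙 : ∀ {p} {P : Set p} → Dec P → ℕ
𝟙 d = if does d then 1 else 0

module _ {p} {P : Set p} where

  𝟙-yes : (d : Dec P) → P → 𝟙 d ≡ 1
  𝟙-yes (yes _) _ = refl
  𝟙-yes (no ¬x) x = contradiction x ¬x

  𝟙-no : (d : Dec P) → ¬ P → 𝟙 d ≡ 0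
  𝟙-no (yes x) ¬x = contradiction x ¬x
  𝟙-no (no _)  _  = refl

  𝟙≤1 : (d : Dec P) → 𝟙 d ≤ 1
  𝟙≤1 (yes _) = ≤-refl
  𝟙≤1 (no _)  = z≤n

  *-𝟙-≤ : ∀ m (d : Dec P) → m * 𝟙 d ≤ m
  *-𝟙-≤ m d = ≤-trans (*-monoʳ-≤ m (𝟙≤1 d)) (≤-reflexive (*-identityʳ m))

𝟙-×-dec : ∀ {a b} {A : Set a} {B : Set b} (x : Dec A) (y : Dec B) → 𝟙 (x ×-dec y) ≡ 𝟙 x * 𝟙 y
𝟙-×-dec (yes _) (yes _) = refl
𝟙-×-dec (yes _) (no _)  = refl
𝟙-×-dec (no _)  _       = refl

𝟙-<-suc : ∀ a m → 𝟙 (a <? suc m) ≡ 𝟙 (a <? m) + 𝟙 (a ≟ m)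
𝟙-<-suc a m with <-cmp a m
... | tri< a<m a≢m _
  rewrite 𝟙-yes (a <? suc m) (m<n⇒m<1+n a<m) | 𝟙-yes (a <? m) a<m | 𝟙-no (a ≟ m) a≢m = refl
... | tri≈ a≮m refl _
  rewrite 𝟙-yes (a <? suc a) (n<1+n a) | 𝟙-no (a <? a) a≮m | 𝟙-yes (a ≟ a) refl = refl
... | tri> a≮m a≢m m<a
  rewrite 𝟙-no (a <? suc m) (<⇒≱ m<a ∘′ s≤s⁻¹) | 𝟙-no (a <? m) a≮m | 𝟙-no (a ≟ m) a≢m = refl

suc-∸ : ∀ a m → suc m ∸ a ≡ (m ∸ a) + 𝟙 (a <? suc m)
suc-∸ a m with a ≤? m
... | yes a≤m rewrite 𝟙-yes (a <? suc m) (s≤s a≤m) = trans (+-∸-assoc 1 a≤m) (+-comm 1 (m ∸ a))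
... | no a≰m  rewrite 𝟙-no (a <? suc m) (a≰m ∘′ s≤s⁻¹)
                    | m≤n⇒m∸n≡0 (≰⇒> a≰m) | m≤n⇒m∸n≡0 (<⇒≤ (≰⇒> a≰m)) = refl

𝟙-<-*-∸ : ∀ a m → 𝟙 (a <? m) * (m ∸ a) ≡ m ∸ a
𝟙-<-*-∸ a m with a <? m
... | yes a<m rewrite 𝟙-yes (a <? m) a<m = +-identityʳ (m ∸ a)
... | no a≮m  rewrite 𝟙-no (a <? m) a≮m = sym (m≤n⇒m∸n≡0 (≮⇒≥ a≮m))

∑-zero : ∀ {n} {f : Fin n → ℕ} → (∀ i → f i ≡ 0) → ∑[ i < n ] f i ≡ 0
∑-zero {n} f≡0 = trans (sum-cong-≗ f≡0) (sum-replicate-zero n)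

∑-mono-≤ : ∀ {n} {f g : Fin n → ℕ} → (∀ i → f i ≤ g i) → ∑[ i < n ] f i ≤ ∑[ i < n ] g i
∑-mono-≤ {zero}  f≤g = z≤n
∑-mono-≤ {suc n} f≤g = +-mono-≤ (f≤g zero) (∑-mono-≤ λ i → f≤g (suc i))

sum-map-tabulate : ∀ {a} {A : Set a} {n} (f : A → ℕ) (g : Fin n → A) →
                   List.sum (map f (tabulate g)) ≡ ∑[ i < n ] f (g i)
sum-map-tabulate {n = zero}  f g = refl
sum-map-tabulate {n = suc n} f g = cong (f (g zero) +_) (sum-map-tabulate f (g ∘′ suc))

length-filter-tabulate : ∀ {a p} {A : Set a} {P : Pred A p} (P? : Decidable P) {n} (g : Fin n → A) →
                         length (filter P? (tabulate g)) ≡ ∑[ i < n ] 𝟙 (P? (g i))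
length-filter-tabulate P? {zero}  g = refl
length-filter-tabulate P? {suc n} g with does (P? (g zero))
... | true  = cong suc (length-filter-tabulate P? (g ∘′ suc))
... | false = length-filter-tabulate P? (g ∘′ suc)

∑-𝟙-≟-≤1 : ∀ {n} (x : Fin n → ℕ) → Injective _≡_ _≡_ x → ∀ m → ∑[ j < n ] 𝟙 (x j ≟ m) ≤ 1
∑-𝟙-≟-≤1 {zero}  x x-inj m = z≤n
∑-𝟙-≟-≤1 {suc n} x x-inj m with x zero ≟ m
... | yes x₀≡m = ≤-reflexive (cong₂ _+_ (𝟙-yes (x zero ≟ m) x₀≡m) (∑-zero λ j →
  𝟙-no (x (suc j) ≟ m) λ e → Fin.0≢1+n (x-inj (trans x₀≡m (sym e)))))
... | no x₀≢m rewrite 𝟙-no (x zero ≟ m) x₀≢m = ∑-𝟙-≟-≤1 (x ∘′ suc) (λ e → Fin.suc-injective (x-inj e)) m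

∑-𝟙-<-toℕ : ∀ {n} (t : Fin n) → ∑[ j < n ] 𝟙 (toℕ j <? toℕ t) ≡ toℕ t
∑-𝟙-<-toℕ {suc n} zero    = sum-replicate-zero n
∑-𝟙-<-toℕ {suc n} (suc t) = cong suc (∑-𝟙-<-toℕ t)

triangular-step : ∀ {c c′} s → c′ ≤ suc c → c * suc c ≤ 2 * s → c′ * suc c′ ≤ 2 * (s + c′)
triangular-step {c′ = zero}  s _     _ = z≤n
triangular-step {c} {suc d} s 1+d≤1+c h = begin
  suc d * suc (suc d)     ≡⟨ expand d ⟩
  d * suc d + 2 * suc d   ≤⟨ +-monoˡ-≤ (2 * suc d) (≤-trans (*-mono-≤ d≤c (s≤s d≤c)) h) ⟩
  2 * s + 2 * suc d       ≡⟨ *-distribˡ-+ 2 s (suc d) ⟨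
  2 * (s + suc d)         ∎
  where
    open ≤-Reasoning
    d≤c = s≤s⁻¹ 1+d≤1+c
    expand : ∀ d → suc d * suc (suc d) ≡ d * suc d + 2 * suc d
    expand = solve-∀

module _ {n q} {Q : Pred (Fin n) q} (x : Fin n → ℕ) (Q? : Decidable Q) where

  countBelow : ℕ → ℕ
  countBelow m = ∑[ j < n ] (𝟙 (x j <? m) * 𝟙 (Q? j))

  gapSum : ℕ → ℕ
  gapSum m = ∑[ j < n ] (𝟙 (Q? j) * (m ∸ x j))

  countBelow-suc : Injective _≡_ _≡_ x → ∀ m → countBelow (suc m) ≤ suc (countBelow m)
  countBelow-suc x-inj m = begin
    countBelow (suc m)
      ≡⟨ sum-cong-≗ (λ j → trans (cong (_* 𝟙 (Q? j)) (𝟙-<-suc (x j) m))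
                                 (*-distribʳ-+ (𝟙 (Q? j)) (𝟙 (x j <? m)) (𝟙 (x j ≟ m)))) ⟩
    ∑[ j < n ] (𝟙 (x j <? m) * 𝟙 (Q? j) + 𝟙 (x j ≟ m) * 𝟙 (Q? j))
      ≡⟨ ∑-distrib-+ (λ j → 𝟙 (x j <? m) * 𝟙 (Q? j)) (λ j → 𝟙 (x j ≟ m) * 𝟙 (Q? j)) ⟩
    countBelow m + ∑[ j < n ] (𝟙 (x j ≟ m) * 𝟙 (Q? j))
      ≤⟨ +-monoʳ-≤ (countBelow m) (∑-mono-≤ λ j → *-𝟙-≤ (𝟙 (x j ≟ m)) (Q? j)) ⟩
    countBelow m + ∑[ j < n ] 𝟙 (x j ≟ m)
      ≤⟨ +-monoʳ-≤ (countBelow m) (∑-𝟙-≟-≤1 x x-inj m) ⟩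
    countBelow m + 1
      ≡⟨ +-comm (countBelow m) 1 ⟩
    suc (countBelow m) ∎
    where open ≤-Reasoning

  gapSum-suc : ∀ m → gapSum (suc m) ≡ gapSum m + countBelow (suc m)
  gapSum-suc m = trans (sum-cong-≗ split)
                       (∑-distrib-+ (λ j → 𝟙 (Q? j) * (m ∸ x j)) (λ j → 𝟙 (x j <? suc m) * 𝟙 (Q? j)))
    where
      split : ∀ j → 𝟙 (Q? j) * (suc m ∸ x j) ≡ 𝟙 (Q? j) * (m ∸ x j) + 𝟙 (x j <? suc m) * 𝟙 (Q? j)
      split j = begin
        𝟙 (Q? j) * (suc m ∸ x j)                                  ≡⟨ cong (𝟙 (Q? j) *_) (suc-∸ (x j) m) ⟩
        𝟙 (Q? j) * ((m ∸ x j) + 𝟙 (x j <? suc m))                 ≡⟨ *-distribˡ-+ (𝟙 (Q? j)) _ _ ⟩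
        𝟙 (Q? j) * (m ∸ x j) + 𝟙 (Q? j) * 𝟙 (x j <? suc m)        ≡⟨ cong (𝟙 (Q? j) * (m ∸ x j) +_) (*-comm (𝟙 (Q? j)) (𝟙 (x j <? suc m))) ⟩
        𝟙 (Q? j) * (m ∸ x j) + 𝟙 (x j <? suc m) * 𝟙 (Q? j)        ∎
        where open ≡-Reasoning

  -- c distinct values below m lie at distances ≥ 1, 2, …, c from m, so their gaps add up to at least c(c+1)/2.
  countBelow-triangular : Injective _≡_ _≡_ x → ∀ m → countBelow m * suc (countBelow m) ≤ 2 * gapSum m
  countBelow-triangular x-inj zero
    rewrite ∑-zero {f = λ j → 𝟙 (x j <? 0) * 𝟙 (Q? j)} (λ j → refl) = z≤n
  countBelow-triangular x-inj (suc m) =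
    subst (λ s → countBelow (suc m) * suc (countBelow (suc m)) ≤ 2 * s) (sym (gapSum-suc m))
      (triangular-step (gapSum m) (countBelow-suc x-inj m) (countBelow-triangular x-inj m))

inversion-balance : ∀ a b c d → (a ≡ b → c ≡ d) → (c ≡ d → a ≡ b) →
                    𝟙 (a <? b) + 𝟙 (b <? a) * 𝟙 (c <? d) ≡ 𝟙 (a <? b) * 𝟙 (d <? c) + 𝟙 (c <? d)
inversion-balance a b c d ab⇒cd cd⇒ab with <-cmp a b
... | tri< a<b a≢b b≮a rewrite 𝟙-yes (a <? b) a<b | 𝟙-no (b <? a) b≮a with <-cmp c d
...   | tri< c<d _ d≮c rewrite 𝟙-yes (c <? d) c<d | 𝟙-no (d <? c) d≮c = refl
...   | tri≈ _ c≡d _   = contradiction (cd⇒ab c≡d) a≢b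
...   | tri> c≮d _ d<c rewrite 𝟙-no (c <? d) c≮d | 𝟙-yes (d <? c) d<c = refl
inversion-balance a b c d ab⇒cd cd⇒ab | tri≈ a≮b a≡b b≮a
  rewrite 𝟙-no (a <? b) a≮b | 𝟙-no (b <? a) b≮a | 𝟙-no (c <? d) (λ c<d → <⇒≢ c<d (ab⇒cd a≡b)) = refl
inversion-balance a b c d ab⇒cd cd⇒ab | tri> a≮b _ b<a
  rewrite 𝟙-no (a <? b) a≮b | 𝟙-yes (b <? a) b<a = +-identityʳ (𝟙 (c <? d))

-- The support hypothesis makes every truncated difference w j ∸ w i exact.
∑-gaps : ∀ {n} (w : Fin n → ℕ) (I : Fin n → Fin n → ℕ) → (∀ i j → w j < w i → I i j ≡ 0) →
         ∑[ j < n ] ∑[ i < n ] (I i j * (w j ∸ w i)) + ∑[ i < n ] (w i * ∑[ j < n ] I i j)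
           ≡ ∑[ j < n ] (w j * ∑[ i < n ] I i j)
∑-gaps {n} w I supported = begin
  ∑[ j < n ] ∑[ i < n ] (I i j * (w j ∸ w i)) + ∑[ i < n ] (w i * ∑[ j < n ] I i j)
    ≡⟨ cong (∑[ j < n ] ∑[ i < n ] (I i j * (w j ∸ w i)) +_) outgoing ⟩
  ∑[ j < n ] ∑[ i < n ] (I i j * (w j ∸ w i)) + ∑[ j < n ] ∑[ i < n ] (I i j * w i)
    ≡⟨ ∑-distrib-+ (λ j → ∑[ i < n ] (I i j * (w j ∸ w i))) (λ j → ∑[ i < n ] (I i j * w i)) ⟨
  ∑[ j < n ] (∑[ i < n ] (I i j * (w j ∸ w i)) + ∑[ i < n ] (I i j * w i))
    ≡⟨ sum-cong-≗ (λ j → ∑-distrib-+ (λ i → I i j * (w j ∸ w i)) (λ i → I i j * w i)) ⟨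
  ∑[ j < n ] ∑[ i < n ] (I i j * (w j ∸ w i) + I i j * w i)
    ≡⟨ sum-cong-≗ (λ j → sum-cong-≗ (λ i → gap+start≡end i j)) ⟩
  ∑[ j < n ] ∑[ i < n ] (I i j * w j)
    ≡⟨ sum-cong-≗ (λ j → trans (*-comm (w j) (∑[ i < n ] I i j)) (*-distribʳ-sum (w j) (λ i → I i j))) ⟨
  ∑[ j < n ] (w j * ∑[ i < n ] I i j) ∎
  where
    open ≡-Reasoning

    outgoing : ∑[ i < n ] (w i * ∑[ j < n ] I i j) ≡ ∑[ j < n ] ∑[ i < n ] (I i j * w i)
    outgoing = begin
      ∑[ i < n ] (w i * ∑[ j < n ] I i j)     ≡⟨ sum-cong-≗ (λ i → *-distribˡ-sum (w i) (I i)) ⟩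
      ∑[ i < n ] ∑[ j < n ] (w i * I i j)     ≡⟨ ∑-comm (λ i j → w i * I i j) ⟩
      ∑[ j < n ] ∑[ i < n ] (w i * I i j)     ≡⟨ sum-cong-≗ (λ j → sum-cong-≗ (λ i → *-comm (w i) (I i j))) ⟩
      ∑[ j < n ] ∑[ i < n ] (I i j * w i)     ∎

    gap+start≡end : ∀ i j → I i j * (w j ∸ w i) + I i j * w i ≡ I i j * w j
    gap+start≡end i j with w i ≤? w j
    ... | yes wi≤wj = trans (sym (*-distribˡ-+ (I i j) (w j ∸ w i) (w i))) (cong (I i j *_) (m∸n+n≡m wi≤wj))
    ... | no wi≰wj rewrite supported i j (≰⇒> wi≰wj) = refl

∣-∣²+2*≡²+²-≤ : ∀ {a b} → a ≤ b → ∣ a - b ∣ * ∣ a - b ∣ + 2 * (a * b) ≡ a * a + b * b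
∣-∣²+2*≡²+²-≤ {a} a≤b with m≤n⇒∃[o]m+o≡n a≤b
... | k , refl rewrite ∣m-m+n∣≡n a k = identity a k
  where identity : ∀ a k → k * k + 2 * (a * (a + k)) ≡ a * a + (a + k) * (a + k)
        identity = solve-∀

∣-∣²+2*≡²+² : ∀ a b → ∣ a - b ∣ * ∣ a - b ∣ + 2 * (a * b) ≡ a * a + b * b
∣-∣²+2*≡²+² a b with ≤-total a b
... | inj₁ a≤b = ∣-∣²+2*≡²+²-≤ a≤b
... | inj₂ b≤a = begin
  ∣ a - b ∣ * ∣ a - b ∣ + 2 * (a * b)   ≡⟨ cong₂ (λ d e → d * d + 2 * e) (∣-∣-comm a b) (*-comm a b) ⟩
  ∣ b - a ∣ * ∣ b - a ∣ + 2 * (b * a)   ≡⟨ ∣-∣²+2*≡²+²-≤ b≤a ⟩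
  b * b + a * a                         ≡⟨ +-comm (b * b) (a * a) ⟩
  a * a + b * b                         ∎
  where open ≡-Reasoning

+-square-≤ : ∀ a b → (a + b) * (a + b) ≤ 2 * (a * a + b * b)
+-square-≤ a b = begin
  (a + b) * (a + b)                              ≡⟨ expand a b ⟩
  (a * a + b * b) + 2 * (a * b)                  ≤⟨ +-monoʳ-≤ (a * a + b * b) (m≤n+m (2 * (a * b)) (∣ a - b ∣ * ∣ a - b ∣)) ⟩
  (a * a + b * b) + (∣ a - b ∣ * ∣ a - b ∣ + 2 * (a * b)) ≡⟨ cong (a * a + b * b +_) (∣-∣²+2*≡²+² a b) ⟩
  (a * a + b * b) + (a * a + b * b)              ≡⟨ double (a * a + b * b) ⟩
  2 * (a * a + b * b)                            ∎
  where
    open ≤-Reasoning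
    expand : ∀ a b → (a + b) * (a + b) ≡ (a * a + b * b) + 2 * (a * b)
    expand = solve-∀
    double : ∀ s → s + s ≡ 2 * s
    double = solve-∀

module Inversions {n} (π : Permutation′ n) where

  ρ : Fin n → ℕ
  ρ i = toℕ (pos π i)

  ρ-injective : Injective _≡_ _≡_ ρ
  ρ-injective {i} {j} ρi≡ρj = begin
    i                   ≡⟨ inverseʳ π ⟨
    π ⟨$⟩ʳ pos π i      ≡⟨ cong (π ⟨$⟩ʳ_) (Fin.toℕ-injective ρi≡ρj) ⟩
    π ⟨$⟩ʳ pos π j      ≡⟨ inverseʳ π ⟩
    j                   ∎
    where open ≡-Reasoning

  inversion : Fin n → Fin n → ℕ
  inversion i j = 𝟙 (toℕ i <? toℕ j) * 𝟙 (ρ j <? ρ i)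

  left right leftGap rightGap : Fin n → ℕ
  left t     = ∑[ j < n ] inversion j t
  right t    = ∑[ j < n ] inversion t j
  leftGap t  = ∑[ j < n ] (inversion j t * (toℕ t ∸ toℕ j))
  rightGap t = ∑[ j < n ] (inversion t j * (ρ t ∸ ρ j))

  vLeft≡left : ∀ t → vLeft π t ≡ left t
  vLeft≡left t = trans (length-filter-tabulate (λ j → (j Fin.<? t) ×-dec (pos π t Fin.<? pos π j)) id)
                       (sum-cong-≗ λ j → 𝟙-×-dec (toℕ j <? toℕ t) (ρ t <? ρ j))

  vRight≡right : ∀ t → vRight π t ≡ right t
  vRight≡right t = trans (length-filter-tabulate (λ j → (t Fin.<? j) ×-dec (pos π j Fin.<? pos π t)) id)
                         (sum-cong-≗ λ j → 𝟙-×-dec (toℕ t <? toℕ j) (ρ j <? ρ t))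

  left-triangular : ∀ t → left t * suc (left t) ≤ 2 * leftGap t
  left-triangular t = subst (λ g → left t * suc (left t) ≤ 2 * g) (sum-cong-≗ weight)
    (countBelow-triangular toℕ (λ j → ρ t <? ρ j) Fin.toℕ-injective (toℕ t))
    where
      weight : ∀ j → 𝟙 (ρ t <? ρ j) * (toℕ t ∸ toℕ j) ≡ inversion j t * (toℕ t ∸ toℕ j)
      weight j = begin
        𝟙 (ρ t <? ρ j) * (toℕ t ∸ toℕ j)                           ≡⟨ cong (𝟙 (ρ t <? ρ j) *_) (𝟙-<-*-∸ (toℕ j) (toℕ t)) ⟨
        𝟙 (ρ t <? ρ j) * (𝟙 (toℕ j <? toℕ t) * (toℕ t ∸ toℕ j))    ≡⟨ *-assoc (𝟙 (ρ t <? ρ j)) _ _ ⟨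
        𝟙 (ρ t <? ρ j) * 𝟙 (toℕ j <? toℕ t) * (toℕ t ∸ toℕ j)      ≡⟨ cong (_* (toℕ t ∸ toℕ j)) (*-comm (𝟙 (ρ t <? ρ j)) _) ⟩
        inversion j t * (toℕ t ∸ toℕ j)                                   ∎
        where open ≡-Reasoning

  right-triangular : ∀ t → right t * suc (right t) ≤ 2 * rightGap t
  right-triangular t = subst₂ (λ c g → c * suc c ≤ 2 * g) (sum-cong-≗ count) (sum-cong-≗ weight)
    (countBelow-triangular ρ (λ j → toℕ t <? toℕ j) ρ-injective (ρ t))
    where
      count : ∀ j → 𝟙 (ρ j <? ρ t) * 𝟙 (toℕ t <? toℕ j) ≡ inversion t j
      count j = *-comm (𝟙 (ρ j <? ρ t)) (𝟙 (toℕ t <? toℕ j))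
      weight : ∀ j → 𝟙 (toℕ t <? toℕ j) * (ρ t ∸ ρ j) ≡ inversion t j * (ρ t ∸ ρ j)
      weight j = trans (cong (𝟙 (toℕ t <? toℕ j) *_) (sym (𝟙-<-*-∸ (ρ j) (ρ t))))
                       (sym (*-assoc (𝟙 (toℕ t <? toℕ j)) _ _))

  ∑-𝟙-<-ρ : ∀ t → ∑[ j < n ] 𝟙 (ρ j <? ρ t) ≡ ρ t
  ∑-𝟙-<-ρ t = trans (sym (∑-permute (λ u → 𝟙 (toℕ u <? ρ t)) (flip π))) (∑-𝟙-<-toℕ (pos π t))

  -- Both sides count the j with j < t or ρ j < ρ t.
  balance : ∀ t → toℕ t + right t ≡ ρ t + left t
  balance t = begin
    toℕ t + right t
      ≡⟨ cong (_+ right t) (∑-𝟙-<-toℕ t) ⟨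
    ∑[ j < n ] 𝟙 (toℕ j <? toℕ t) + right t
      ≡⟨ ∑-distrib-+ (λ j → 𝟙 (toℕ j <? toℕ t)) (λ j → inversion t j) ⟨
    ∑[ j < n ] (𝟙 (toℕ j <? toℕ t) + inversion t j)
      ≡⟨ sum-cong-≗ (λ j → inversion-balance (toℕ j) (toℕ t) (ρ j) (ρ t)
                              (λ e → cong ρ (Fin.toℕ-injective e)) (λ e → cong toℕ (ρ-injective e))) ⟩
    ∑[ j < n ] (inversion j t + 𝟙 (ρ j <? ρ t))
      ≡⟨ ∑-distrib-+ (λ j → inversion j t) (λ j → 𝟙 (ρ j <? ρ t)) ⟩
    left t + ∑[ j < n ] 𝟙 (ρ j <? ρ t)
      ≡⟨ cong (left t +_) (∑-𝟙-<-ρ t) ⟩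
    left t + ρ t
      ≡⟨ +-comm (left t) (ρ t) ⟩
    ρ t + left t ∎
    where open ≡-Reasoning

  weighted-balance : ∀ (w : Fin n → ℕ) →
    ∑[ t < n ] (w t * toℕ t) + ∑[ t < n ] (w t * right t) ≡ ∑[ t < n ] (w t * ρ t) + ∑[ t < n ] (w t * left t)
  weighted-balance w = begin
    ∑[ t < n ] (w t * toℕ t) + ∑[ t < n ] (w t * right t)
      ≡⟨ ∑-distrib-+ (λ t → w t * toℕ t) (λ t → w t * right t) ⟨
    ∑[ t < n ] (w t * toℕ t + w t * right t)
      ≡⟨ sum-cong-≗ (λ t → trans (sym (*-distribˡ-+ (w t) (toℕ t) (right t)))
                          (trans (cong (w t *_) (balance t)) (*-distribˡ-+ (w t) (ρ t) (left t)))) ⟩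
    ∑[ t < n ] (w t * ρ t + w t * left t)
      ≡⟨ ∑-distrib-+ (λ t → w t * ρ t) (λ t → w t * left t) ⟩
    ∑[ t < n ] (w t * ρ t) + ∑[ t < n ] (w t * left t) ∎
    where open ≡-Reasoning

  ∑-leftGap : ∑[ t < n ] leftGap t + ∑[ t < n ] (toℕ t * right t) ≡ ∑[ t < n ] (toℕ t * left t)
  ∑-leftGap = ∑-gaps toℕ inversion λ i j j<i → cong (_* 𝟙 (ρ j <? ρ i)) (𝟙-no (toℕ i <? toℕ j) (<⇒≯ j<i))

  ∑-rightGap : ∑[ t < n ] rightGap t + ∑[ t < n ] (ρ t * left t) ≡ ∑[ t < n ] (ρ t * right t)
  ∑-rightGap = ∑-gaps ρ (λ i j → inversion j i) λ i j ρj<ρi →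
    trans (cong (𝟙 (toℕ j <? toℕ i) *_) (𝟙-no (ρ i <? ρ j) (<⇒≯ ρj<ρi))) (*-zeroʳ (𝟙 (toℕ j <? toℕ i)))

  ∑-toℕ² : ∑[ t < n ] (toℕ t * toℕ t) ≡ ∑[ t < n ] (toℕ t * ρ t) + ∑[ t < n ] leftGap t
  ∑-toℕ² = +-cancelʳ-≡ (∑[ t < n ] (toℕ t * right t)) _ _ (begin
    ∑[ t < n ] (toℕ t * toℕ t) + ∑[ t < n ] (toℕ t * right t)    ≡⟨ weighted-balance toℕ ⟩
    ∑[ t < n ] (toℕ t * ρ t) + ∑[ t < n ] (toℕ t * left t)        ≡⟨ cong (∑[ t < n ] (toℕ t * ρ t) +_) ∑-leftGap ⟨
    ∑[ t < n ] (toℕ t * ρ t) + (∑[ t < n ] leftGap t + ∑[ t < n ] (toℕ t * right t))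
      ≡⟨ +-assoc (∑[ t < n ] (toℕ t * ρ t)) _ _ ⟨
    ∑[ t < n ] (toℕ t * ρ t) + ∑[ t < n ] leftGap t + ∑[ t < n ] (toℕ t * right t) ∎)
    where open ≡-Reasoning

  ∑-ρ² : ∑[ t < n ] (ρ t * ρ t) ≡ ∑[ t < n ] (toℕ t * ρ t) + ∑[ t < n ] rightGap t
  ∑-ρ² = +-cancelʳ-≡ (∑[ t < n ] (ρ t * left t)) _ _ (begin
    ∑[ t < n ] (ρ t * ρ t) + ∑[ t < n ] (ρ t * left t)            ≡⟨ weighted-balance ρ ⟨
    ∑[ t < n ] (ρ t * toℕ t) + ∑[ t < n ] (ρ t * right t)         ≡⟨ cong₂ _+_ (sum-cong-≗ λ t → *-comm (ρ t) (toℕ t)) (sym ∑-rightGap) ⟩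
    ∑[ t < n ] (toℕ t * ρ t) + (∑[ t < n ] rightGap t + ∑[ t < n ] (ρ t * left t))
      ≡⟨ +-assoc (∑[ t < n ] (toℕ t * ρ t)) _ _ ⟨
    ∑[ t < n ] (toℕ t * ρ t) + ∑[ t < n ] rightGap t + ∑[ t < n ] (ρ t * left t) ∎)
    where open ≡-Reasoning

  normSqDiffId≡∑gaps : normSqDiffId π ≡ ∑[ t < n ] leftGap t + ∑[ t < n ] rightGap t
  normSqDiffId≡∑gaps = trans (sum-map-tabulate (λ t → ∣ toℕ t - ρ t ∣ * ∣ toℕ t - ρ t ∣) id) (+-cancelʳ-≡ (2 * M) _ _ (begin
    ∑[ t < n ] (∣ toℕ t - ρ t ∣ * ∣ toℕ t - ρ t ∣) + 2 * M
      ≡⟨ cong (∑[ t < n ] (∣ toℕ t - ρ t ∣ * ∣ toℕ t - ρ t ∣) +_) (*-distribˡ-sum 2 (λ t → toℕ t * ρ t)) ⟩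
    ∑[ t < n ] (∣ toℕ t - ρ t ∣ * ∣ toℕ t - ρ t ∣) + ∑[ t < n ] (2 * (toℕ t * ρ t))
      ≡⟨ ∑-distrib-+ (λ t → ∣ toℕ t - ρ t ∣ * ∣ toℕ t - ρ t ∣) (λ t → 2 * (toℕ t * ρ t)) ⟨
    ∑[ t < n ] (∣ toℕ t - ρ t ∣ * ∣ toℕ t - ρ t ∣ + 2 * (toℕ t * ρ t))
      ≡⟨ sum-cong-≗ (λ t → ∣-∣²+2*≡²+² (toℕ t) (ρ t)) ⟩
    ∑[ t < n ] (toℕ t * toℕ t + ρ t * ρ t)
      ≡⟨ ∑-distrib-+ (λ t → toℕ t * toℕ t) (λ t → ρ t * ρ t) ⟩
    ∑[ t < n ] (toℕ t * toℕ t) + ∑[ t < n ] (ρ t * ρ t)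
      ≡⟨ cong₂ _+_ ∑-toℕ² ∑-ρ² ⟩
    (M + ∑[ t < n ] leftGap t) + (M + ∑[ t < n ] rightGap t)
      ≡⟨ regroup M (∑[ t < n ] leftGap t) (∑[ t < n ] rightGap t) ⟩
    ∑[ t < n ] leftGap t + ∑[ t < n ] rightGap t + 2 * M ∎))
    where
      open ≡-Reasoning
      M = ∑[ t < n ] (toℕ t * ρ t)
      regroup : ∀ m a b → (m + a) + (m + b) ≡ a + b + 2 * m
      regroup = solve-∀

  square-≤-gaps : ∀ t → (left t + right t) * (left t + right t) ≤ 4 * (leftGap t + rightGap t)
  square-≤-gaps t = begin
    (left t + right t) * (left t + right t)            ≤⟨ +-square-≤ (left t) (right t) ⟩
    2 * (left t * left t + right t * right t)          ≤⟨ *-monoʳ-≤ 2 (+-mono-≤ (*-monoʳ-≤ (left t) (n≤1+n (left t)))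
                                                                                (*-monoʳ-≤ (right t) (n≤1+n (right t)))) ⟩
    2 * (left t * suc (left t) + right t * suc (right t)) ≤⟨ *-monoʳ-≤ 2 (+-mono-≤ (left-triangular t) (right-triangular t)) ⟩
    2 * (2 * leftGap t + 2 * rightGap t)               ≡⟨ regroup (leftGap t) (rightGap t) ⟩
    4 * (leftGap t + rightGap t)                       ∎
    where
      open ≤-Reasoning
      regroup : ∀ a b → 2 * (2 * a + 2 * b) ≡ 4 * (a + b)
      regroup = solve-∀

claim6p18 : (n : ℕ) (π : Permutation′ n) →
    Σ[ n ] (λ t → (vLeft π t + vRight π t) * (vLeft π t + vRight π t)) ≤ 4 * normSqDiffId π
claim6p18 n π = begin
  Σ[ n ] (λ t → (vLeft π t + vRight π t) * (vLeft π t + vRight π t))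
    ≡⟨ sum-map-tabulate (λ t → (vLeft π t + vRight π t) * (vLeft π t + vRight π t)) id ⟩
  ∑[ t < n ] ((vLeft π t + vRight π t) * (vLeft π t + vRight π t))
    ≡⟨ sum-cong-≗ (λ t → cong (λ s → s * s) (cong₂ _+_ (vLeft≡left t) (vRight≡right t))) ⟩
  ∑[ t < n ] ((left t + right t) * (left t + right t))
    ≤⟨ ∑-mono-≤ square-≤-gaps ⟩
  ∑[ t < n ] (4 * (leftGap t + rightGap t))
    ≡⟨ *-distribˡ-sum 4 (λ t → leftGap t + rightGap t) ⟨
  4 * ∑[ t < n ] (leftGap t + rightGap t)
    ≡⟨ cong (4 *_) (trans (∑-distrib-+ leftGap rightGap) (sym normSqDiffId≡∑gaps)) ⟩
  4 * normSqDiffId π ∎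
  where
    open Inversions π
    open ≤-Reasoning
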